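{- The complement of a complete bipartite graph is a divisor graph.
   Context: A graph $G$ is a divisor graph if it is isomorphic to the graph $G(S)$ on some nonempty set $S$ of positive integers in which distinct $i,j\in S$ are adjacent iff $i\mid j$ or $j\mid i$. -}

module Defs where

open import Level using (Level; suc; _⊔_)
open import Data.Nat using (ℕ; _>_)
open import Data.Nat.Divisibility using (_∣_)
open import Data.Fin using (Fin)
open import Data.Sum using (_⊎_; inj₁; inj₂)
open import Data.Product using (Σ; _×_)
open import Data.Empty using (⊥)
open import Data.Unit using (⊤; tt)
open import Relation.Nullary using (¬_)
open import Relation.Binary.PropositionalEquality using (_≡_)
open import Function.Bundles using (_⇔_)
open import Function.Definitions using (Injective)

record Graph (ℓ : Level) : Set (suc ℓ) where
  field
    Vertex : Set ℓ
    Adj    : Vertex → Vertex → Set ℓ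
    sym    : ∀ {u v} → Adj u v → Adj v u
    irrefl : ∀ {u} → ¬ Adj u u

DivAdj : ℕ → ℕ → Set
DivAdj i j = (i ∣ j) ⊎ (j ∣ i)

-- G is a divisor graph: G ≅ G(S) for some nonempty set S of positive integers.
-- Equivalently (S = image of f): an injective labelling f of the vertices by
-- positive integers such that distinct vertices are adjacent iff their labels
-- are related by divisibility, with the vertex set nonempty.
IsDivisorGraph : ∀ {ℓ} → Graph ℓ → Set ℓ
IsDivisorGraph G =
  Vertex × Σ (Vertex → ℕ) λ f →
    Injective _≡_ _≡_ f
    × (∀ v → f v > 0)
    × (∀ u v → ¬ u ≡ v → Adj u v ⇔ DivAdj (f u) (f v))
  where open Graph G

complement : ∀ {ℓ} → Graph ℓ → Graph ℓ
complement G = record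
  { Vertex = Vertex
  ; Adj    = λ u v → ¬ u ≡ v × ¬ Adj u v
  ; sym    = λ { (u≢v , ¬a) → (λ e → u≢v (Eq.sym e)) , (λ a → ¬a (Graph.sym G a)) }
  ; irrefl = λ { (u≢u , _) → u≢u Eq.refl }
  }
  where
    open Graph G
    import Relation.Binary.PropositionalEquality as Eq
    open Data.Product using (_,_)

BipAdj : ∀ {m n} → Fin m ⊎ Fin n → Fin m ⊎ Fin n → Set
BipAdj (inj₁ _) (inj₁ _) = ⊥
BipAdj (inj₁ _) (inj₂ _) = ⊤
BipAdj (inj₂ _) (inj₁ _) = ⊤
BipAdj (inj₂ _) (inj₂ _) = ⊥

completeBipartite : ℕ → ℕ → Graph Level.zero
completeBipartite m n = record
  { Vertex = Fin m ⊎ Fin n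
  ; Adj    = BipAdj
  ; sym    = λ { {inj₁ _} {inj₂ _} _ → tt ; {inj₂ _} {inj₁ _} _ → tt
               ; {inj₁ _} {inj₁ _} () ; {inj₂ _} {inj₂ _} () }
  ; irrefl = λ { {inj₁ _} () ; {inj₂ _} () }
  }

-- Label the two sides of K_{m,n} by the powers 2^1, 2^2, … and 3^1, 3^2, … .
-- Powers of one base form a divisibility chain, so each side becomes a clique,
-- while a nontrivial power of 2 and a nontrivial power of 3 never divide one
-- another, so no edge joins the two sides: this is exactly the complement.
module Submission where

open import Defs
open import Data.Nat using (ℕ; zero; suc; _^_; _≤_; _<_; _≥_; _>_; s≤s; z<s; s<s; >-nonZero)
open import Data.Nat.Properties
  using (≤-total; ≤-antisym; ≮⇒≥; <⇒≢; >⇒≢; ^-monoʳ-<; m^n>0; suc-injective; <-trans)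
open import Data.Nat.Divisibility using (_∣_; _∤_; 1∣_; ∣-trans; ∣-reflexive; m∣m*n; *-monoʳ-∣; ∣1⇒≡1)
open import Data.Nat.Coprimality using (Coprime; coprime?; coprime-divisor)
import Data.Nat.Coprimality as Coprime
open import Data.Fin using (Fin; toℕ; zero)
open import Data.Fin.Properties using (toℕ-injective)
open import Data.Sum using (_⊎_; inj₁; inj₂; [_,_])
import Data.Sum as Sum
open import Data.Product using (_×_; _,_)
open import Data.Empty using (⊥-elim)
open import Data.Unit using (tt)
open import Relation.Nullary using (¬_)
open import Relation.Nullary.Decidable using (toWitness)
open import Relation.Binary.PropositionalEquality using (_≡_; _≢_; sym; cong)
open import Function.Bundles using (_⇔_; mk⇔; module Equivalence)
open import Function.Definitions using (Injective)

^-monoʳ-∣ : ∀ p {a b} → a ≤ b → p ^ a ∣ p ^ b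
^-monoʳ-∣ p {zero}  _         = 1∣ _
^-monoʳ-∣ p {suc a} (s≤s a≤b) = *-monoʳ-∣ p (^-monoʳ-∣ p a≤b)

^-divAdj : ∀ p a b → DivAdj (p ^ a) (p ^ b)
^-divAdj p a b = Sum.map (^-monoʳ-∣ p) (^-monoʳ-∣ p) (≤-total a b)

^-injectiveʳ : ∀ p → 1 < p → Injective _≡_ _≡_ (p ^_)
^-injectiveʳ p 1<p {a} {b} pᵃ≡pᵇ = ≤-antisym
  (≮⇒≥ λ b<a → <⇒≢ (^-monoʳ-< p 1<p b<a) (sym pᵃ≡pᵇ))
  (≮⇒≥ λ a<b → <⇒≢ (^-monoʳ-< p 1<p a<b) pᵃ≡pᵇ)

coprime⇒∤^ : ∀ {d q} → Coprime d q → d ≢ 1 → ∀ k → d ∤ q ^ k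
coprime⇒∤^ d⊥q d≢1 zero    d∣1   = d≢1 (∣1⇒≡1 d∣1)
coprime⇒∤^ d⊥q d≢1 (suc k) d∣qqᵏ = coprime⇒∤^ d⊥q d≢1 k (coprime-divisor d⊥q d∣qqᵏ)

coprime⇒^-suc-∤^ : ∀ {p q} → Coprime p q → 1 < p → ∀ a b → p ^ suc a ∤ q ^ b
coprime⇒^-suc-∤^ {p} p⊥q 1<p a b pᵃ⁺¹∣qᵇ =
  coprime⇒∤^ p⊥q (>⇒≢ 1<p) b (∣-trans (m∣m*n (p ^ a)) pᵃ⁺¹∣qᵇ)

sideLabel : ∀ {m n} → ℕ → ℕ → Fin m ⊎ Fin n → ℕ
sideLabel p q (inj₁ i) = p ^ suc (toℕ i)
sideLabel p q (inj₂ j) = q ^ suc (toℕ j)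

module _ {p q : ℕ} (1<p : 1 < p) (1<q : 1 < q) (p⊥q : Coprime p q) {m n : ℕ} where

  private
    label : Fin m ⊎ Fin n → ℕ
    label = sideLabel p q

  ¬divAdj-^-suc : ∀ a b → ¬ DivAdj (p ^ suc a) (q ^ suc b)
  ¬divAdj-^-suc a b =
    [ coprime⇒^-suc-∤^ p⊥q 1<p a (suc b) , coprime⇒^-suc-∤^ (Coprime.sym p⊥q) 1<q b (suc a) ]

  sideLabel-divAdj⇔¬BipAdj : ∀ u v → DivAdj (label u) (label v) ⇔ (¬ BipAdj u v)
  sideLabel-divAdj⇔¬BipAdj (inj₁ i) (inj₁ j) = mk⇔ (λ _ ()) (λ _ → ^-divAdj p (suc (toℕ i)) (suc (toℕ j)))
  sideLabel-divAdj⇔¬BipAdj (inj₂ i) (inj₂ j) = mk⇔ (λ _ ()) (λ _ → ^-divAdj q (suc (toℕ i)) (suc (toℕ j)))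
  sideLabel-divAdj⇔¬BipAdj (inj₁ i) (inj₂ j) =
    mk⇔ (λ d → ⊥-elim (¬divAdj-^-suc (toℕ i) (toℕ j) d)) (λ ¬adj → ⊥-elim (¬adj tt))
  sideLabel-divAdj⇔¬BipAdj (inj₂ i) (inj₁ j) =
    mk⇔ (λ d → ⊥-elim (¬divAdj-^-suc (toℕ j) (toℕ i) (Sum.swap d))) (λ ¬adj → ⊥-elim (¬adj tt))

  sideLabel-injective : Injective _≡_ _≡_ label
  sideLabel-injective {inj₁ i} {inj₁ j} eq =
    cong inj₁ (toℕ-injective (suc-injective (^-injectiveʳ p 1<p {suc (toℕ i)} {suc (toℕ j)} eq)))
  sideLabel-injective {inj₂ i} {inj₂ j} eq =
    cong inj₂ (toℕ-injective (suc-injective (^-injectiveʳ q 1<q {suc (toℕ i)} {suc (toℕ j)} eq)))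
  sideLabel-injective {inj₁ i} {inj₂ j} eq = ⊥-elim (¬divAdj-^-suc (toℕ i) (toℕ j) (inj₁ (∣-reflexive eq)))
  sideLabel-injective {inj₂ i} {inj₁ j} eq = ⊥-elim (¬divAdj-^-suc (toℕ j) (toℕ i) (inj₁ (∣-reflexive (sym eq))))

  sideLabel-positive : ∀ v → label v > 0
  sideLabel-positive (inj₁ i) = m^n>0 p {{>-nonZero (<-trans z<s 1<p)}} (suc (toℕ i))
  sideLabel-positive (inj₂ j) = m^n>0 q {{>-nonZero (<-trans z<s 1<q)}} (suc (toℕ j))

proposition2p1 : ∀ (m n : ℕ) → m ≥ 1 → n ≥ 1 → IsDivisorGraph (complement (completeBipartite m n))
proposition2p1 (suc m) n _ _ =
  inj₁ zero , sideLabel 2 3 , sideLabel-injective 1<2 1<3 2⊥3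
  , sideLabel-positive 1<2 1<3 2⊥3 , adjacency
  where
  1<2 : 1 < 2
  1<2 = s<s z<s
  1<3 : 1 < 3
  1<3 = s<s z<s
  2⊥3 : Coprime 2 3
  2⊥3 = toWitness {a? = coprime? 2 3} tt
  adjacency : ∀ u v → u ≢ v → (u ≢ v × ¬ BipAdj u v) ⇔ DivAdj (sideLabel 2 3 u) (sideLabel 2 3 v)
  adjacency u v u≢v = mk⇔ (λ (_ , ¬adj) → from ¬adj) (λ d → u≢v , to d)
    where open Equivalence (sideLabel-divAdj⇔¬BipAdj 1<2 1<3 2⊥3 u v)
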